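{- Let $n$ be a positive integer and $B_n$ the Boolean lattice of subsets of $\{1,2,\dots,n\}$ ordered by inclusion. Then $\chi_D(B_n)\le n+3$.
   Context: For a finite poset $P$, a coloring is proper if comparable points get different colors and distinguishing if the only color-preserving automorphism of $P$ is the identity; $\chi_D(P)$ is the least number of colors in a proper distinguishing coloring of $P$. -}

module Defs where

open import Data.Nat using (ℕ)
open import Data.Fin using (Fin)
open import Data.Fin.Subset using (Subset; _⊆_)
open import Data.Product using (Σ; _×_)
open import Relation.Binary.PropositionalEquality using (_≡_; _≢_)

record Automorphism (P : Set) (_≤_ : P → P → Set) : Set where
  field
    to      : P → P
    from    : P → P
    to-from : ∀ x → to (from x) ≡ x
    from-to : ∀ x → from (to x) ≡ x
    mono    : ∀ {x y} → x ≤ y → to x ≤ to y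
    reflect : ∀ {x y} → to x ≤ to y → x ≤ y

open Automorphism public

Coloring : (P : Set) → ℕ → Set
Coloring P k = P → Fin k

Proper : {P : Set} (_≤_ : P → P → Set) {k : ℕ} → Coloring P k → Set
Proper {P} _≤_ c = ∀ (x y : P) → x ≤ y → x ≢ y → c x ≢ c y

Distinguishing : {P : Set} (_≤_ : P → P → Set) {k : ℕ} → Coloring P k → Set
Distinguishing {P} _≤_ c =
  ∀ (σ : Automorphism P _≤_) → (∀ x → c (to σ x) ≡ c x) → ∀ x → to σ x ≡ x

χD≤ : (P : Set) (_≤_ : P → P → Set) → ℕ → Set
χD≤ P _≤_ m = Σ ℕ λ k → (k Data.Nat.≤ m) × Σ (Coloring P k) λ c → Proper _≤_ c × Distinguishing _≤_ c

B : ℕ → Set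
B n = Subset n

_⊆B_ : {n : ℕ} → B n → B n → Set
_⊆B_ = _⊆_

module Submission where

-- Write the ground set of B_n as Fin n with n = suc m, and colour a subset T by
--   col T = ∣ T ∣ + [0 ∈ T] + [T contains two consecutive numbers],
-- a number in 0 … n + 2.  The colouring is proper because a strict inclusion
-- raises the size and both indicator bits are monotone under inclusion.
--
-- It is distinguishing by an argument about an arbitrary automorphism σ of B_n:
--   * σ preserves sizes (a monotone injective self-map of B_n never shrinks a
--     set), so σ permutes the atoms: σ ⁅ i ⁆ = ⁅ π i ⁆, and i ∈ S ⇔ π i ∈ σ S;
--     in particular σ is the identity as soon as π is.
--   * If σ preserves colours, it preserves sizes and hence the two bits.
--     Comparing bits on ⁅ 0 ⁆ gives π 0 = 0; then σ preserves the bit [0 ∈ T],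
--     hence also the consecutive-pair bit.  Applying this to ⁅ i - 1 , i ⁆ and
--     using well-founded induction on i shows π i = i for every i.

open import Defs
open import Data.Nat using (ℕ; _≤_; _+_)

open import Data.Nat using (zero; suc; _<_; z≤n; s≤s; s≤s⁻¹)
open import Data.Nat.Properties
  using (≤-trans; ≤-refl; ≤-reflexive; ≤-antisym; ≤∧≢⇒<; <-irrefl; +-mono-≤; +-suc;
         +-identityʳ; +-cancelˡ-≡; 1+n≢n; n≤1+n)
open import Data.Fin as Fin using (Fin; toℕ; fromℕ<; inject₁) renaming (zero to fz; suc to fs)
open import Data.Fin.Properties using (toℕ-injective; toℕ-fromℕ<; toℕ-inject₁; ≤̄⇒inject₁<; any?)
open import Data.Fin.Induction using (<-wellFounded)
open import Data.Fin.Subset using (Subset; _⊆_; _∈_; ⁅_⁆; _∪_; _-_; ∣_∣; inside; outside)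
open import Data.Fin.Subset.Properties
  using (_∈?_; x∈⁅x⁆; x∈⁅y⁆⇒x≡y; ∣⁅x⁆∣≡1; ∣p∣≤n; ∣⊥∣≡0; p─⊥≡p; p⊆q⇒∣p∣≤∣q∣;
         p⊂q⇒∣p∣<∣q∣; ⊂-irref; ⊆-antisym; x∈p⇒p-x⊂p; p─q⊆p; nonempty?; Empty-unique;
         x∈p∪q⁺; x∈p∪q⁻)
open import Data.Vec using (_∷_; _[_]=_)
open _[_]=_
open import Data.Product using (Σ; _×_; _,_; proj₁; proj₂)
open import Data.Sum using (_⊎_; inj₁; inj₂)
open import Data.Empty using (⊥-elim)
open import Induction.WellFounded using (module All)
open import Level using (0ℓ)
open import Relation.Nullary using (Dec; yes; no; ¬_)
open import Relation.Nullary.Decidable using (_×-dec_)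
open import Relation.Binary.PropositionalEquality
  using (_≡_; _≢_; refl; sym; trans; cong; cong₂; subst; subst₂; module ≡-Reasoning)

remove-card : ∀ {n} {x : Fin n} {p : Subset n} → x ∈ p → ∣ p ∣ ≡ suc ∣ p - x ∣
remove-card {x = fz}   {inside ∷ p}  here      = cong suc (sym (cong ∣_∣ (p─⊥≡p p)))
remove-card {x = fs x} {inside ∷ p}  (there m) = cong suc (remove-card m)
remove-card {x = fs x} {outside ∷ p} (there m) = remove-card m

⊆∧∣≡∣⇒≡ : ∀ {n} {p q : Subset n} → p ⊆ q → ∣ p ∣ ≡ ∣ q ∣ → p ≡ q
⊆∧∣≡∣⇒≡ {p = p} p⊆q same = ⊆-antisym p⊆q q⊆p
  where
  q⊆p : _ ⊆ p
  q⊆p {x} x∈q with x ∈? p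
  ... | yes x∈p = x∈p
  ... | no  x∉p = ⊥-elim (<-irrefl same (p⊂q⇒∣p∣<∣q∣ (p⊆q , x , x∈q , x∉p)))

⊆∧≢⇒< : ∀ {n} {p q : Subset n} → p ⊆ q → p ≢ q → ∣ p ∣ < ∣ q ∣
⊆∧≢⇒< p⊆q p≢q = ≤∧≢⇒< (p⊆q⇒∣p∣≤∣q∣ p⊆q) (λ same → p≢q (⊆∧∣≡∣⇒≡ p⊆q same))

⁅⁆⊆ : ∀ {n} {x : Fin n} {p : Subset n} → x ∈ p → ⁅ x ⁆ ⊆ p
⁅⁆⊆ {x = x} x∈p y∈⁅x⁆ = subst (_∈ _) (sym (x∈⁅y⁆⇒x≡y x y∈⁅x⁆)) x∈p

card-one⇒singleton : ∀ {n} (p : Subset n) → ∣ p ∣ ≡ 1 → Σ (Fin n) λ x → ⁅ x ⁆ ≡ p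
card-one⇒singleton {n} p one with nonempty? p
... | yes (x , x∈p) = x , ⊆∧∣≡∣⇒≡ (⁅⁆⊆ x∈p) (trans (∣⁅x⁆∣≡1 x) (sym one))
... | no  empty     = ⊥-elim (1+n≢n (trans (sym one) (trans (cong ∣_∣ (Empty-unique empty)) (∣⊥∣≡0 n))))

-- A monotone injective self-map of B_n never decreases size: removing a member
-- x of p gives h (p - x) ⊂ h p, so by induction ∣ p ∣ = 1 + ∣ p - x ∣ ≤ ∣ h p ∣.
-- The induction runs over an upper bound k on ∣ p ∣.
module MonotoneInjective {n} (h : Subset n → Subset n)
  (h-mono : ∀ {p q} → p ⊆ q → h p ⊆ h q) (h-inj : ∀ {p q} → h p ≡ h q → p ≡ q) where

  card-bounded : ∀ k p → ∣ p ∣ ≤ k → ∣ p ∣ ≤ ∣ h p ∣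
  card-bounded zero    p ∣p∣≤0 = ≤-trans ∣p∣≤0 z≤n
  card-bounded (suc k) p ∣p∣≤k with nonempty? p
  ... | no empty = ≤-trans (≤-reflexive (trans (cong ∣_∣ (Empty-unique empty)) (∣⊥∣≡0 n))) z≤n
  ... | yes (x , x∈p) = subst (_≤ ∣ h p ∣) (sym size) (≤-trans (s≤s ih) shrink)
    where
    size = remove-card x∈p
    ih : ∣ p - x ∣ ≤ ∣ h (p - x) ∣
    ih = card-bounded k (p - x) (s≤s⁻¹ (subst (_≤ suc k) size ∣p∣≤k))
    shrink : ∣ h (p - x) ∣ < ∣ h p ∣
    shrink = ⊆∧≢⇒< (h-mono (p─q⊆p p ⁅ x ⁆))
                   (λ same → ⊂-irref (h-inj same) (x∈p⇒p-x⊂p x∈p))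

  card-≤ : ∀ p → ∣ p ∣ ≤ ∣ h p ∣
  card-≤ p = card-bounded ∣ p ∣ p ≤-refl

module BooleanAutomorphism {n} (σ : Automorphism (B n) _⊆B_) where

  s r : Subset n → Subset n
  s = to σ
  r = from σ

  s-inj : ∀ {p q} → s p ≡ s q → p ≡ q
  s-inj {p} {q} e = trans (sym (from-to σ p)) (trans (cong r e) (from-to σ q))

  r-inj : ∀ {p q} → r p ≡ r q → p ≡ q
  r-inj {p} {q} e = trans (sym (to-from σ p)) (trans (cong s e) (to-from σ q))

  r-mono : ∀ {p q} → p ⊆ q → r p ⊆ r q
  r-mono {p} {q} p⊆q = reflect σ (subst₂ _⊆_ (sym (to-from σ p)) (sym (to-from σ q)) p⊆q)

  -- Applying the size bound to σ and to σ⁻¹ shows that σ preserves sizes.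
  card-preserved : ∀ p → ∣ s p ∣ ≡ ∣ p ∣
  card-preserved p = ≤-antisym
    (≤-trans (MonotoneInjective.card-≤ r r-mono r-inj (s p)) (≤-reflexive (cong ∣_∣ (from-to σ p))))
    (MonotoneInjective.card-≤ s (mono σ) s-inj p)

  π : Fin n → Fin n
  π i = proj₁ (card-one⇒singleton (s ⁅ i ⁆) (trans (card-preserved ⁅ i ⁆) (∣⁅x⁆∣≡1 i)))

  s⁅i⁆≡⁅πi⁆ : ∀ i → s ⁅ i ⁆ ≡ ⁅ π i ⁆
  s⁅i⁆≡⁅πi⁆ i = sym (proj₂ (card-one⇒singleton (s ⁅ i ⁆) (trans (card-preserved ⁅ i ⁆) (∣⁅x⁆∣≡1 i))))

  ∈-preserved : ∀ {i S} → i ∈ S → π i ∈ s S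
  ∈-preserved {i} i∈S = mono σ (⁅⁆⊆ i∈S) (subst (π i ∈_) (sym (s⁅i⁆≡⁅πi⁆ i)) (x∈⁅x⁆ (π i)))

  ∈-reflected : ∀ {i S} → π i ∈ s S → i ∈ S
  ∈-reflected {i} {S} πi∈sS = reflect σ (subst (_⊆ s S) (sym (s⁅i⁆≡⁅πi⁆ i)) (⁅⁆⊆ πi∈sS)) (x∈⁅x⁆ i)

  π-injective : ∀ {a b} → π a ≡ π b → a ≡ b
  π-injective {a} {b} e = x∈⁅y⁆⇒x≡y b (∈-reflected (subst (_∈ s ⁅ b ⁆) (sym e) (∈-preserved (x∈⁅x⁆ b))))

  image : ∀ {S y} → y ∈ s S → Σ (Fin n) λ j → j ∈ S × π j ≡ y
  image {S} {y} y∈sS = j , ∈-reflected (subst (_∈ s S) (sym πj≡y) y∈sS) , πj≡y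
    where
    preimage = card-one⇒singleton (r ⁅ y ⁆)
      (trans (sym (card-preserved (r ⁅ y ⁆))) (trans (cong ∣_∣ (to-from σ ⁅ y ⁆)) (∣⁅x⁆∣≡1 y)))
    j = proj₁ preimage
    πj≡y : π j ≡ y
    πj≡y = x∈⁅y⁆⇒x≡y y (subst (π j ∈_) (to-from σ ⁅ y ⁆)
             (∈-preserved (subst (j ∈_) (proj₂ preimage) (x∈⁅x⁆ j))))

  pair-image : ∀ {a b y} → y ∈ s (⁅ a ⁆ ∪ ⁅ b ⁆) → y ≡ π a ⊎ y ≡ π b
  pair-image {a} {b} y∈ with image y∈
  ... | j , j∈ , refl with x∈p∪q⁻ ⁅ a ⁆ ⁅ b ⁆ j∈
  ...   | inj₁ j∈⁅a⁆ = inj₁ (cong π (x∈⁅y⁆⇒x≡y a j∈⁅a⁆))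
  ...   | inj₂ j∈⁅b⁆ = inj₂ (cong π (x∈⁅y⁆⇒x≡y b j∈⁅b⁆))

  atoms-fixed⇒identity : (∀ i → π i ≡ i) → ∀ S → s S ≡ S
  atoms-fixed⇒identity fixed S = ⊆-antisym
    (λ {y} y∈sS → ∈-reflected (subst (_∈ s S) (sym (fixed y)) y∈sS))
    (λ {y} y∈S → subst (_∈ s S) (fixed y) (∈-preserved y∈S))

bit : ∀ {P : Set} → Dec P → ℕ
bit (yes _) = 1
bit (no _)  = 0

bit≤1 : ∀ {P : Set} (d : Dec P) → bit d ≤ 1
bit≤1 (yes _) = s≤s z≤n
bit≤1 (no _)  = z≤n

bit-mono : ∀ {P Q : Set} (dP : Dec P) (dQ : Dec Q) → (P → Q) → bit dP ≤ bit dQ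
bit-mono (yes p) (yes _) _   = ≤-refl
bit-mono (yes p) (no ¬q) P→Q = ⊥-elim (¬q (P→Q p))
bit-mono (no _)  _       _   = z≤n

bit-cong : ∀ {P Q : Set} (dP : Dec P) (dQ : Dec Q) → (P → Q) → (Q → P) → bit dP ≡ bit dQ
bit-cong dP dQ P→Q Q→P = ≤-antisym (bit-mono dP dQ P→Q) (bit-mono dQ dP Q→P)

bit-yes : ∀ {P : Set} (d : Dec P) → P → bit d ≡ 1
bit-yes (yes _) _ = refl
bit-yes (no ¬p) p = ⊥-elim (¬p p)

bit-no : ∀ {P : Set} (d : Dec P) → ¬ P → bit d ≡ 0
bit-no (yes p) ¬p = ⊥-elim (¬p p)
bit-no (no _)  _  = refl

bit-1 : ∀ {P : Set} (d : Dec P) → bit d ≡ 1 → P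
bit-1 (yes p) _ = p
bit-1 (no _)  ()

module Colouring (m : ℕ) where

  N : ℕ
  N = suc m

  Consecutive : Subset N → Set
  Consecutive T = Σ (Fin N) λ a → Σ (Fin N) λ b → a ∈ T × b ∈ T × toℕ b ≡ suc (toℕ a)

  consecutive? : ∀ T → Dec (Consecutive T)
  consecutive? T = any? λ a → any? λ b → (a ∈? T) ×-dec ((b ∈? T) ×-dec (toℕ b Data.Nat.≟ suc (toℕ a)))

  singleton-no-consecutive : ∀ c → ¬ Consecutive ⁅ c ⁆
  singleton-no-consecutive c (a , b , a∈ , b∈ , b≡1+a) =
    1+n≢n (sym (trans (cong toℕ (trans (x∈⁅y⁆⇒x≡y c a∈) (sym (x∈⁅y⁆⇒x≡y c b∈)))) b≡1+a))

  adjacent-pair : ∀ (i : Fin m) → Consecutive (⁅ inject₁ i ⁆ ∪ ⁅ fs i ⁆)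
  adjacent-pair i = inject₁ i , fs i , x∈p∪q⁺ (inj₁ (x∈⁅x⁆ _)) , x∈p∪q⁺ (inj₂ (x∈⁅x⁆ _)) ,
                    cong suc (sym (toℕ-inject₁ i))

  bits : Subset N → ℕ
  bits T = bit (fz ∈? T) + bit (consecutive? T)

  value : Subset N → ℕ
  value T = ∣ T ∣ + bits T

  value< : ∀ T → value T < N + 3
  value< T = ≤-trans (s≤s (+-mono-≤ (∣p∣≤n T) (+-mono-≤ (bit≤1 (fz ∈? T)) (bit≤1 (consecutive? T)))))
                     (≤-reflexive (sym (+-suc N 2)))

  col : Coloring (B N) (N + 3)
  col T = fromℕ< (value< T)

  col⇒value : ∀ {x y} → col x ≡ col y → value x ≡ value y
  col⇒value {x} {y} eq = trans (sym (toℕ-fromℕ< (value< x))) (trans (cong toℕ eq) (toℕ-fromℕ< (value< y)))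

  bits-mono : ∀ {x y} → x ⊆ y → bits x ≤ bits y
  bits-mono {x} {y} x⊆y = +-mono-≤ (bit-mono (fz ∈? x) (fz ∈? y) x⊆y)
    (bit-mono (consecutive? x) (consecutive? y) λ { (a , b , a∈ , b∈ , e) → a , b , x⊆y a∈ , x⊆y b∈ , e })

  -- A strict inclusion raises the size and does not lower the bits.
  proper : Proper _⊆B_ col
  proper x y x⊆y x≢y same = <-irrefl (col⇒value {x} {y} same) (+-mono-≤ (⊆∧≢⇒< x⊆y x≢y) (bits-mono x⊆y))

module ColouringIsDistinguishing (m : ℕ) (σ : Automorphism (B (suc m)) _⊆B_)
  (col-preserved : ∀ x → Colouring.col m (to σ x) ≡ Colouring.col m x) where
  open Colouring m
  open BooleanAutomorphism σ

  -- Equal colours and equal sizes force equal bits.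
  bits-preserved : ∀ S → bits (s S) ≡ bits S
  bits-preserved S = +-cancelˡ-≡ ∣ S ∣ _ _
    (subst (λ k → k + bits (s S) ≡ value S) (card-preserved S) (col⇒value {s S} {S} (col-preserved S)))

  -- ⁅ 0 ⁆ has bits 1 + 0, and its image ⁅ π 0 ⁆ has no consecutive pair, so 0 ∈ ⁅ π 0 ⁆.
  π-fixes-zero : π fz ≡ fz
  π-fixes-zero = sym (x∈⁅y⁆⇒x≡y (π fz) (subst (fz ∈_) (s⁅i⁆≡⁅πi⁆ fz) (bit-1 (fz ∈? s S) zero-bit)))
    where
    open ≡-Reasoning
    S = ⁅ fz ⁆
    image-no-consecutive : ¬ Consecutive (s S)
    image-no-consecutive = subst (λ T → ¬ Consecutive T) (sym (s⁅i⁆≡⁅πi⁆ fz)) (singleton-no-consecutive (π fz))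
    zero-bit : bit (fz ∈? s S) ≡ 1
    zero-bit = begin
      bit (fz ∈? s S)        ≡⟨ sym (+-identityʳ _) ⟩
      bit (fz ∈? s S) + 0    ≡⟨ cong (bit (fz ∈? s S) +_) (sym (bit-no (consecutive? (s S)) image-no-consecutive)) ⟩
      bits (s S)             ≡⟨ bits-preserved S ⟩
      bits S                 ≡⟨ cong₂ _+_ (bit-yes (fz ∈? S) (x∈⁅x⁆ fz)) (bit-no (consecutive? S) (singleton-no-consecutive fz)) ⟩
      1                      ∎

  -- Since σ fixes the atom 0, it preserves the bit [0 ∈ S], hence the other bit.
  consecutive-preserved : ∀ S → Consecutive S → Consecutive (s S)
  consecutive-preserved S pair = bit-1 (consecutive? (s S)) (+-cancelˡ-≡ (bit (fz ∈? S)) _ _ (begin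
    bit (fz ∈? S) + bit (consecutive? (s S))   ≡⟨ cong (_+ bit (consecutive? (s S))) zero-bit ⟩
    bits (s S)                                 ≡⟨ bits-preserved S ⟩
    bits S                                     ≡⟨ cong (bit (fz ∈? S) +_) (bit-yes (consecutive? S) pair) ⟩
    bit (fz ∈? S) + 1                          ∎))
    where
    open ≡-Reasoning
    zero-bit : bit (fz ∈? S) ≡ bit (fz ∈? s S)
    zero-bit = bit-cong (fz ∈? S) (fz ∈? s S)
      (λ 0∈S → subst (_∈ s S) π-fixes-zero (∈-preserved 0∈S))
      (λ 0∈sS → ∈-reflected (subst (_∈ s S) (sym π-fixes-zero) 0∈sS))

  -- Induction step: if π fixes every atom below i + 1, then the image
  -- ⁅ i , π (i + 1) ⁆ of ⁅ i , i + 1 ⁆ contains a consecutive pair.  Either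
  -- π (i + 1) = i + 1 directly, or π (i + 1) + 1 = i; then π (i + 1) lies below
  -- i + 1, so π fixes it, and injectivity of π gives π (i + 1) = i + 1 anyway.
  π-fixes-successor : ∀ (i' : Fin m) → (∀ {g} → g Fin.< fs i' → π g ≡ g) → π (fs i') ≡ fs i'
  π-fixes-successor i' fixed-below
    with consecutive-preserved (⁅ inject₁ i' ⁆ ∪ ⁅ fs i' ⁆) (adjacent-pair i')
  ... | a , b , a∈ , b∈ , b≡1+a with pair-image {inject₁ i'} {fs i'} a∈ | pair-image {inject₁ i'} {fs i'} b∈
  ... | inj₁ refl | inj₁ refl = ⊥-elim (1+n≢n (sym b≡1+a))
  ... | inj₂ refl | inj₂ refl = ⊥-elim (1+n≢n (sym b≡1+a))
  ... | inj₁ refl | inj₂ refl = toℕ-injective (begin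
    toℕ (π (fs i'))            ≡⟨ b≡1+a ⟩
    suc (toℕ (π (inject₁ i'))) ≡⟨ cong (λ g → suc (toℕ g)) (fixed-below (≤̄⇒inject₁< (≤-refl {toℕ i'}))) ⟩
    suc (toℕ (inject₁ i'))     ≡⟨ cong suc (toℕ-inject₁ i') ⟩
    toℕ (fs i')                ∎)
    where open ≡-Reasoning
  ... | inj₂ refl | inj₁ refl = π-injective (fixed-below (s≤s (begin
    toℕ (π (fs i'))            ≤⟨ n≤1+n _ ⟩
    suc (toℕ (π (fs i')))      ≡⟨ sym b≡1+a ⟩
    toℕ (π (inject₁ i'))       ≡⟨ cong toℕ (fixed-below (≤̄⇒inject₁< (≤-refl {toℕ i'}))) ⟩
    toℕ (inject₁ i')           ≡⟨ toℕ-inject₁ i' ⟩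
    toℕ i'                     ∎)))
    where open Data.Nat.Properties.≤-Reasoning

  π-fixes-all : ∀ i → π i ≡ i
  π-fixes-all = All.wfRec <-wellFounded 0ℓ (λ i → π i ≡ i) step
    where
    step : ∀ i → (∀ {g} → g Fin.< i → π g ≡ g) → π i ≡ i
    step fz      _           = π-fixes-zero
    step (fs i') fixed-below = π-fixes-successor i' fixed-below

  σ-is-identity : ∀ S → s S ≡ S
  σ-is-identity = atoms-fixed⇒identity π-fixes-all

theorem4p9 : (n : ℕ) → 1 ≤ n → χD≤ (B n) _⊆B_ (n + 3)
theorem4p9 (suc m) _ =
  suc m + 3 , ≤-refl , col , proper , ColouringIsDistinguishing.σ-is-identity m
  where open Colouring m
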